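{- Let $m\ge 2$ be an integer. The group $\mathrm{Aut}^*(R_m)$ splits over its normal subgroup $\mathrm{Aut}(R_m)$ (that is, there is a subgroup $K\le \mathrm{Aut}^*(R_m)$ with $K\cap \mathrm{Aut}(R_m)=1$ and $K\cdot\mathrm{Aut}(R_m)=\mathrm{Aut}^*(R_m)$) if and only if $m$ is odd.
   Context: Fix an integer $m\ge 2$. An $m$-edge-coloured complete graph is a complete graph each of whose edges is assigned one of the colours $1,\dots,m$. $R_m$ denotes the unique (up to isomorphism) countable $m$-edge-coloured complete graph which is universal (every finite or countable $m$-edge-coloured complete graph embeds in it, colour-preservingly) and homogeneous (every colour-preserving isomorphism between finite induced subgraphs extends to a colour-preserving automorphism of $R_m$). $\mathrm{Aut}(R_m)$ is the group of permutations of the vertex set of $R_m$ preserving the colour of every edge. $\mathrm{Aut}^*(R_m)$ is the group of permutations $g$ of the vertex set of $R_m$ which induce a permutation of the colours, i.e. for which there is a permutation $\pi$ of $\{1,\dots,m\}$ such that for all edges $\{u,v\}$, the colour of $\{u^g,v^g\}$ is $\pi$ applied to the colour of $\{u,v\}$. $\mathrm{Aut}(R_m)$ is a normal subgroup of $\mathrm{Aut}^*(R_m)$, and the induced action on colours gives $\mathrm{Aut}^*(R_m)/\mathrm{Aut}(R_m)\cong \mathrm{Sym}(m)$. -}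

module Defs where

open import Level using (Level; 0ℓ) renaming (suc to lsuc)
open import Data.Nat using (ℕ; suc; _*_)
open import Data.Fin using (Fin)
open import Data.Product using (Σ; ∃; _×_; _,_)
open import Relation.Binary.PropositionalEquality using (_≡_; _≢_)
open import Relation.Nullary using (¬_)
open import Function.Bundles using (Inverse; _↔_)
open import Function.Construct.Identity using (↔-id)
open import Function.Construct.Symmetry using (↔-sym)
open import Function.Construct.Composition using (_↔-∘_)
open import Data.Fin.Permutation using (Permutation′; _⟨$⟩ʳ_)

Odd : ℕ → Set
Odd m = ∃ λ k → m ≡ suc (2 * k)

-- An m-edge-coloured complete graph on vertex type V:
-- every edge {u,v} (u ≢ v) gets a colour in Fin m (colours 1..m are Fin m);
-- the colour of an edge does not depend on the orientation.
-- (col u u is irrelevant: every definition below only looks at u ≢ v.)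
record ColGraph (m : ℕ) (V : Set) : Set where
  field
    col : V → V → Fin m
    col-sym : ∀ u v → col u v ≡ col v u
open ColGraph public

Embeds : ∀ {m} {V : Set} → ColGraph m V → ColGraph m ℕ → Set
Embeds {V = V} G R =
  Σ (V → ℕ) λ h →
    (∀ u v → h u ≡ h v → u ≡ v) ×
    (∀ u v → u ≢ v → col R (h u) (h v) ≡ col G u v)

Universal : ∀ {m} → ColGraph m ℕ → Set
Universal {m} R =
  (∀ (n : ℕ) (G : ColGraph m (Fin n)) → Embeds G R) ×
  (∀ (G : ColGraph m ℕ) → Embeds G R)

Perm : Set
Perm = ℕ ↔ ℕ

_$_ : Perm → ℕ → ℕ
g $ x = Inverse.to g x

_≈ₚ_ : Perm → Perm → Set
g ≈ₚ h = ∀ x → g $ x ≡ h $ x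

idₚ : Perm
idₚ = ↔-id ℕ

-- composition: (g ∘ₚ h) $ x = g $ (h $ x)
_∘ₚ_ : Perm → Perm → Perm
g ∘ₚ h = g ↔-∘ h

_⁻¹ₚ : Perm → Perm
g ⁻¹ₚ = ↔-sym g

IsAut : ∀ {m} → ColGraph m ℕ → Perm → Set
IsAut R g = ∀ u v → u ≢ v → col R (g $ u) (g $ v) ≡ col R u v

IsAut* : ∀ {m} → ColGraph m ℕ → Perm → Set
IsAut* {m} R g =
  Σ (Permutation′ m) λ π →
    ∀ u v → u ≢ v → col R (g $ u) (g $ v) ≡ π ⟨$⟩ʳ col R u v

-- Homogeneous: every colour-preserving isomorphism a i ↦ b i between finite
-- induced subgraphs (given by injective enumerations a, b : Fin n → ℕ)
-- extends to an automorphism of R.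
Homogeneous : ∀ {m} → ColGraph m ℕ → Set
Homogeneous R =
  ∀ (n : ℕ) (a b : Fin n → ℕ) →
    (∀ i j → a i ≡ a j → i ≡ j) →
    (∀ i j → b i ≡ b j → i ≡ j) →
    (∀ i j → i ≢ j → col R (a i) (a j) ≡ col R (b i) (b j)) →
    Σ Perm λ g → IsAut R g × (∀ i → g $ a i ≡ b i)

record IsSubgroupOfAut* {m} (R : ColGraph m ℕ) (K : Perm → Set) : Set where
  field
    resp    : ∀ {g h} → g ≈ₚ h → K g → K h
    ⊆Aut*   : ∀ {g} → K g → IsAut* R g
    has-id  : K idₚ
    ∘-closed : ∀ {g h} → K g → K h → K (g ∘ₚ h)
    ⁻¹-closed : ∀ {g} → K g → K (g ⁻¹ₚ)

Splits : ∀ {m} → ColGraph m ℕ → Set₁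
Splits R =
  Σ (Perm → Set) λ K →
    IsSubgroupOfAut* R K ×
    (∀ g → K g → IsAut R g → g ≈ₚ idₚ) ×
    (∀ g → IsAut* R g → Σ Perm λ k → Σ Perm λ a → K k × IsAut R a × (g ≈ₚ (k ∘ₚ a)))

module Submission where

-- If m is even, the colour permutation τ : i ↦ m − 1 − i is a fixed-point-free involution.
-- By back-and-forth some g ∈ Aut*(R) induces τ, and in a complement K there is then some
-- κ ∈ K inducing τ; as κ² ∈ K ∩ Aut(R) = 1, κ is an involution. Either κ moves a vertex u,
-- and then τ fixes the colour of {u, κu}, or κ fixes 0 and 1, and τ fixes the colour of {0, 1}.
--
-- If m is odd, let Sym(m) act on ℕ × Sym(m) by σ(i, ρ) = (i, σρ). This set carries a
-- symmetric Sym(m)-equivariant colouring with the extension property, so back-and-forth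
-- identifies it with R and the transported action is a homomorphic section
-- Sym(m) → Aut*(R), whose image is a complement of Aut(R). Oddness is needed within a level:
-- for ρ⁻¹ρ′ an involution, symmetry and equivariance force the colour of {(i, ρ), (i, ρ′)}
-- to be ρ applied to a fixed point of ρ⁻¹ρ′.

open import Defs
open import Data.Empty using (⊥-elim)
open import Data.Fin using (Fin; zero; suc; toℕ; fromℕ<; opposite)
open import Data.Fin.Permutation using (Permutation′; _⟨$⟩ʳ_; _⟨$⟩ˡ_; inverseʳ; inverseˡ)
import Data.Fin.Properties as F
open import Data.Fin.Properties
  using (any?; all?; suc-injective; toℕ<n; fromℕ<-cong; fromℕ<-toℕ; toℕ-fromℕ<;
         opposite-prop; opposite-involutive)
open import Data.Nat
  using (ℕ; zero; suc; s≤s; _+_; _*_; _∸_; _/_; _%_; _⊔_; NonZero; _≤_; _<_; _≤′_; ≤′-refl; ≤′-step)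
open import Data.Nat.DivMod
  using (_mod_; [m+kn]%n≡m%n; m<n⇒m%n≡m; +-distrib-/-∣ʳ; m<n⇒m/n≡0; m*n/n≡m)
open import Data.Nat.Divisibility using (n∣m*n)
open import Data.Nat.Properties
  using (_≟_; <-cmp; <-asym; <-irrefl; ≮⇒≥; ≤-refl; ≤-trans; ≤⇒≤′; m≤m⊔n; m≤n⊔m; m≤m*n; m≤n+m;
         +-suc; +-identityʳ; m∸n+n≡m; even≢odd; +-0-commutativeMonoid; module ≤-Reasoning)
open import Algebra.Properties.CommutativeMonoid.Sum +-0-commutativeMonoid
  using (sum; sum-cong-≗; sum-permute; ∑-distrib-+)
open import Data.Product using (Σ; ∃; ∃₂; _×_; _,_; proj₁; proj₂; map₁; map₂; swap)
open import Data.Sum using (_⊎_; inj₁; inj₂)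
open import Data.Vec using (Vec; []; _∷_; lookup; tabulate)
import Data.Vec.Functional as VF
open import Data.Vec.Properties using (≡-dec; lookup∘tabulate; tabulate∘lookup; tabulate-cong)
open import Function.Base using (_∘_; id)
open import Function.Bundles using (Inverse; _↔_; mk↔ₛ′; _⇔_; mk⇔)
open import Function.Construct.Composition using (_↔-∘_)
open import Function.Construct.Identity using (↔-id)
open import Function.Construct.Symmetry using (↔-sym)
open import Function.Definitions using (Injective)
open import Relation.Binary.Definitions using (DecidableEquality; Tri; tri<; tri≈; tri>)
open import Relation.Binary.PropositionalEquality
  using (_≡_; _≢_; refl; sym; trans; cong; cong₂; module ≡-Reasoning)
open import Relation.Nullary using (¬_; Dec; yes; no)
open import Relation.Nullary.Decidable using (_×-dec_; recompute; map′)

ExtensionProperty : ∀ {m} {X : Set} → (X → X → Fin m) → Set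
ExtensionProperty {m} {X} c =
  ∀ n (a : Fin n → X) → Injective _≡_ _≡_ a → (f : Fin n → Fin m) →
  ∃ λ z → (∀ i → a i ≢ z) × (∀ i → c (a i) z ≡ f i)

∷-injective : ∀ {n} {X : Set} {x : X} {a : Fin n → X} →
  (∀ i → a i ≢ x) → Injective _≡_ _≡_ a → Injective _≡_ _≡_ (x VF.∷ a)
∷-injective _   _     {zero}  {zero}  _ = refl
∷-injective x∉a _     {zero}  {suc j} e = ⊥-elim (x∉a j (sym e))
∷-injective x∉a _     {suc i} {zero}  e = ⊥-elim (x∉a i e)
∷-injective _   a-inj {suc i} {suc j} e = cong suc (a-inj e)

record PartialIso {m} {A B : Set} (cA : A → A → Fin m) (cB : B → B → Fin m) : Set where
  field
    size      : ℕ
    dom       : Fin size → A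
    cod       : Fin size → B
    dom-inj   : Injective _≡_ _≡_ dom
    cod-inj   : Injective _≡_ _≡_ cod
    preserves : ∀ i j → i ≢ j → cB (cod i) (cod j) ≡ cA (dom i) (dom j)

open PartialIso

inverse : ∀ {m} {A B : Set} {cA : A → A → Fin m} {cB : B → B → Fin m} →
  PartialIso cA cB → PartialIso cB cA
inverse p = record
  { size = size p ; dom = cod p ; cod = dom p ; dom-inj = cod-inj p ; cod-inj = dom-inj p
  ; preserves = λ i j i≢j → sym (preserves p i j i≢j) }

module _ {m} {A B : Set} {cA : A → A → Fin m} {cB : B → B → Fin m} where

  _∋_↦_ : PartialIso cA cB → A → B → Set
  p ∋ a ↦ b = ∃ λ i → dom p i ≡ a × cod p i ≡ b

  _⊑_ : PartialIso cA cB → PartialIso cA cB → Set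
  p ⊑ q = ∀ {a b} → p ∋ a ↦ b → q ∋ a ↦ b

  ↦-functional : ∀ p {a b b′} → p ∋ a ↦ b → p ∋ a ↦ b′ → b ≡ b′
  ↦-functional p (i , refl , refl) (j , a≡ , refl) = cong (cod p) (dom-inj p (sym a≡))

  ↦-injective : ∀ p {a a′ b} → p ∋ a ↦ b → p ∋ a′ ↦ b → a ≡ a′
  ↦-injective p (i , refl , refl) (j , refl , b≡) = cong (dom p) (cod-inj p (sym b≡))

  ↦-preserves : ∀ p {a a′ b b′} → p ∋ a ↦ b → p ∋ a′ ↦ b′ → a ≢ a′ → cB b b′ ≡ cA a a′
  ↦-preserves p (i , refl , refl) (j , refl , refl) a≢a′ =
    preserves p i j λ { refl → a≢a′ refl }

  empty : PartialIso cA cB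
  empty = record
    { size = 0 ; dom = λ () ; cod = λ () ; dom-inj = λ {} ; cod-inj = λ {} ; preserves = λ () }

  module Extension (_≟_ : DecidableEquality A)
    (cA-sym : ∀ x y → cA x y ≡ cA y x) (cB-sym : ∀ x y → cB x y ≡ cB y x)
    (extB : ExtensionProperty cB) where

    extend : (p : PartialIso cA cB) (x : A) → (∀ i → dom p i ≢ x) → (z : B) →
      (∀ i → cod p i ≢ z) → (∀ i → cB (cod p i) z ≡ cA (dom p i) x) → PartialIso cA cB
    extend p x x∉p z z∉p z-col = record
      { size = suc (size p) ; dom = x VF.∷ dom p ; cod = z VF.∷ cod p
      ; dom-inj = ∷-injective x∉p (dom-inj p) ; cod-inj = ∷-injective z∉p (cod-inj p)
      ; preserves = preserves′ }
      where
      preserves′ : ∀ i j → i ≢ j →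
        cB ((z VF.∷ cod p) i) ((z VF.∷ cod p) j) ≡ cA ((x VF.∷ dom p) i) ((x VF.∷ dom p) j)
      preserves′ zero    zero    i≢j = ⊥-elim (i≢j refl)
      preserves′ zero    (suc j) _   =
        trans (cB-sym z (cod p j)) (trans (z-col j) (cA-sym (dom p j) x))
      preserves′ (suc i) zero    _   = z-col i
      preserves′ (suc i) (suc j) i≢j = preserves p i j (λ e → i≢j (cong suc e))

    forth : PartialIso cA cB → A → PartialIso cA cB
    forth p x with any? (λ i → dom p i ≟ x)
    ... | yes _   = p
    ... | no  x∉p = extend p x (λ i e → x∉p (i , e)) (proj₁ new) (proj₁ (proj₂ new)) (proj₂ (proj₂ new))
      where
      new : ∃ λ z → (∀ i → cod p i ≢ z) × (∀ i → cB (cod p i) z ≡ cA (dom p i) x)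
      new = extB (size p) (cod p) (cod-inj p) (λ i → cA (dom p i) x)

    forth-extends : ∀ p x → p ⊑ forth p x
    forth-extends p x with any? (λ i → dom p i ≟ x)
    ... | yes _ = λ a↦b → a↦b
    ... | no  _ = λ { (i , a≡ , b≡) → suc i , a≡ , b≡ }

    forth-covers : ∀ p x → ∃ λ b → forth p x ∋ x ↦ b
    forth-covers p x with any? (λ i → dom p i ≟ x)
    ... | yes (i , x≡) = cod p i , i , x≡ , refl
    ... | no  _        = _ , zero , refl , refl

module BackAndForth {m} {A B : Set} {cA : A → A → Fin m} {cB : B → B → Fin m}
  (_≟A_ : DecidableEquality A) (_≟B_ : DecidableEquality B)
  (cA-sym : ∀ x y → cA x y ≡ cA y x) (cB-sym : ∀ x y → cB x y ≡ cB y x)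
  (extA : ExtensionProperty cA) (extB : ExtensionProperty cB)
  (enumA : ℕ → A) (enumA-onto : ∀ a → ∃ λ k → enumA k ≡ a)
  (enumB : ℕ → B) (enumB-onto : ∀ b → ∃ λ k → enumB k ≡ b) where

  private
    module Forth = Extension _≟A_ cA-sym cB-sym extB
    module Back  = Extension _≟B_ cB-sym cA-sym extA

  back : PartialIso cA cB → B → PartialIso cA cB
  back p y = inverse (Back.forth (inverse p) y)

  back-extends : ∀ p y → p ⊑ back p y
  back-extends p y a↦b = map₂ swap (Back.forth-extends (inverse p) y (map₂ swap a↦b))

  back-covers : ∀ p y → ∃ λ a → back p y ∋ a ↦ y
  back-covers p y with Back.forth-covers (inverse p) y
  ... | a , i , y≡ , a≡ = a , i , a≡ , y≡

  stage : ℕ → PartialIso cA cB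
  stage zero    = empty
  stage (suc k) = back (Forth.forth (stage k) (enumA k)) (enumB k)

  stage-step : ∀ k → stage k ⊑ stage (suc k)
  stage-step k a↦b = back-extends _ (enumB k) (Forth.forth-extends (stage k) (enumA k) a↦b)

  stage-mono : ∀ {k k′} → k ≤′ k′ → stage k ⊑ stage k′
  stage-mono ≤′-refl                        a↦b = a↦b
  stage-mono {k′ = suc k′} (≤′-step k≤k′) a↦b = stage-step k′ (stage-mono k≤k′ a↦b)

  Related : A → B → Set
  Related a b = ∃ λ k → stage k ∋ a ↦ b

  common-stage : ∀ {a a′ b b′} → Related a b → Related a′ b′ →
    ∃ λ k → stage k ∋ a ↦ b × stage k ∋ a′ ↦ b′
  common-stage (k , r) (k′ , r′) =
    k ⊔ k′ , stage-mono (≤⇒≤′ (m≤m⊔n k k′)) r , stage-mono (≤⇒≤′ (m≤n⊔m k k′)) r′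

  related-functional : ∀ {a b b′} → Related a b → Related a b′ → b ≡ b′
  related-functional r r′ with common-stage r r′
  ... | k , s , s′ = ↦-functional (stage k) s s′

  related-injective : ∀ {a a′ b} → Related a b → Related a′ b → a ≡ a′
  related-injective r r′ with common-stage r r′
  ... | k , s , s′ = ↦-injective (stage k) s s′

  related-total : ∀ a → ∃ λ b → Related a b
  related-total a with enumA-onto a
  ... | k , refl with Forth.forth-covers (stage k) a
  ... | b , a↦b = b , suc k , back-extends _ (enumB k) a↦b

  related-onto : ∀ b → ∃ λ a → Related a b
  related-onto b with enumB-onto b
  ... | k , refl with back-covers (Forth.forth (stage k) (enumA k)) b
  ... | a , a↦b = a , suc k , a↦b

  opaque
    back-and-forth : Σ (A ↔ B) λ φ → ∀ x y → x ≢ y →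
      cB (Inverse.to φ x) (Inverse.to φ y) ≡ cA x y
    back-and-forth = mk↔ₛ′ to from to-from from-to , preserves′
      where
      to : A → B
      to a = proj₁ (related-total a)
      from : B → A
      from b = proj₁ (related-onto b)
      to-from : ∀ b → to (from b) ≡ b
      to-from b = related-functional (proj₂ (related-total (from b))) (proj₂ (related-onto b))
      from-to : ∀ a → from (to a) ≡ a
      from-to a = related-injective (proj₂ (related-onto (to a))) (proj₂ (related-total a))
      preserves′ : ∀ x y → x ≢ y → cB (to x) (to y) ≡ cA x y
      preserves′ x y x≢y with common-stage (proj₂ (related-total x)) (proj₂ (related-total y))
      ... | k , s , s′ = ↦-preserves (stage k) s s′ x≢y

$-injective : ∀ (g : Perm) {x y} → g $ x ≡ g $ y → x ≡ y
$-injective g {x} {y} e = begin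
  x                       ≡⟨ Inverse.strictlyInverseʳ g x ⟨
  Inverse.from g (g $ x)  ≡⟨ cong (Inverse.from g) e ⟩
  Inverse.from g (g $ y)  ≡⟨ Inverse.strictlyInverseʳ g y ⟩
  y                       ∎
  where open ≡-Reasoning

twist : ∀ {m} {X : Set} → Permutation′ m → (X → X → Fin m) → X → X → Fin m
twist π c u v = π ⟨$⟩ʳ c u v

twist-extension : ∀ {m} {X : Set} {c : X → X → Fin m} (π : Permutation′ m) →
  ExtensionProperty c → ExtensionProperty (twist π c)
twist-extension π ext n a a-inj f with ext n a a-inj (λ i → π ⟨$⟩ˡ f i)
... | z , z∉a , z-col = z , z∉a , λ i → trans (cong (π ⟨$⟩ʳ_) (z-col i)) (inverseʳ π)

colour-occurs : ∀ {m} {X : Set} {c : X → X → Fin m} → ExtensionProperty c → X →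
  ∀ k → ∃₂ λ u v → u ≢ v × c u v ≡ k
colour-occurs ext x k with ext 1 (λ _ → x) (λ { {zero} {zero} _ → refl }) (λ _ → k)
... | z , z∉ , z-col = x , z , z∉ zero , z-col zero

module _ {m} (R : ColGraph m ℕ) where

  open ≡-Reasoning

  oneVertexExtension : ∀ {n} → (Fin n → ℕ) → (Fin n → Fin m) → ColGraph m (Fin (suc n))
  oneVertexExtension {n} a f = record { col = colG ; col-sym = colG-sym }
    where
    colG : Fin (suc n) → Fin (suc n) → Fin m
    colG zero    zero    = col R 0 0
    colG zero    (suc j) = f j
    colG (suc i) zero    = f i
    colG (suc i) (suc j) = col R (a i) (a j)
    colG-sym : ∀ u v → colG u v ≡ colG v u
    colG-sym zero    zero    = refl
    colG-sym zero    (suc j) = refl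
    colG-sym (suc i) zero    = refl
    colG-sym (suc i) (suc j) = col-sym R (a i) (a j)

  universal-homogeneous⇒extension : Universal R → Homogeneous R → ExtensionProperty (col R)
  universal-homogeneous⇒extension (embedFinite , _) homogeneous n a a-inj f
    with embedFinite (suc n) (oneVertexExtension a f)
  ... | h , h-inj , h-col
    with homogeneous n (h ∘ suc) a (λ i j e → suc-injective (h-inj (suc i) (suc j) e))
           (λ i j e → a-inj e) (λ i j i≢j → h-col (suc i) (suc j) (i≢j ∘ suc-injective))
  ... | g , g-aut , g-maps = g $ h zero , new∉a , new-col
    where
    old≢new : ∀ i → h (suc i) ≢ h zero
    old≢new i e with h-inj (suc i) zero e
    ... | ()
    new∉a : ∀ i → a i ≢ g $ h zero
    new∉a i e = old≢new i ($-injective g (trans (g-maps i) e))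
    new-col : ∀ i → col R (a i) (g $ h zero) ≡ f i
    new-col i = begin
      col R (a i) (g $ h zero)           ≡⟨ cong (λ x → col R x (g $ h zero)) (g-maps i) ⟨
      col R (g $ h (suc i)) (g $ h zero) ≡⟨ g-aut (h (suc i)) (h zero) (old≢new i) ⟩
      col R (h (suc i)) (h zero)         ≡⟨ h-col (suc i) zero (λ ()) ⟩
      f i                                ∎

  Induces : Perm → Permutation′ m → Set
  Induces g π = ∀ u v → u ≢ v → col R (g $ u) (g $ v) ≡ π ⟨$⟩ʳ col R u v

  induces-∘ : ∀ {g h π ρ} → Induces g π → Induces h ρ → Induces (g ∘ₚ h) (π ↔-∘ ρ)
  induces-∘ {g} {h} {π} g-π h-ρ u v u≢v =
    trans (g-π (h $ u) (h $ v) (u≢v ∘ $-injective h)) (cong (π ⟨$⟩ʳ_) (h-ρ u v u≢v))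

  every-colour-permutation-induced : Universal R → Homogeneous R → ∀ π → ∃ λ g → Induces g π
  every-colour-permutation-induced universal homogeneous π =
    BackAndForth.back-and-forth {cA = twist π (col R)} {cB = col R} _≟_ _≟_
      (λ u v → cong (π ⟨$⟩ʳ_) (col-sym R u v)) (col-sym R)
      (twist-extension {c = col R} π ext) ext id (_, refl) id (_, refl)
    where
    ext : ExtensionProperty (col R)
    ext = universal-homogeneous⇒extension universal homogeneous

  factor-induces : ∀ {g k a π} → g ≈ₚ (k ∘ₚ a) → IsAut R a → Induces g π → Induces k π
  factor-induces {g} {k} {a} {π} g≈ka a-aut g-π u v u≢v = begin
    col R (k $ u) (k $ v)                     ≡⟨ cong₂ (col R) (k≡g u) (k≡g v) ⟩
    col R (g $ a⁻¹ u) (g $ a⁻¹ v)             ≡⟨ g-π (a⁻¹ u) (a⁻¹ v) a⁻¹u≢a⁻¹v ⟩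
    π ⟨$⟩ʳ col R (a⁻¹ u) (a⁻¹ v)              ≡⟨ cong (π ⟨$⟩ʳ_) (a-aut _ _ a⁻¹u≢a⁻¹v) ⟨
    π ⟨$⟩ʳ col R (a $ a⁻¹ u) (a $ a⁻¹ v)      ≡⟨ cong (π ⟨$⟩ʳ_) (cong₂ (col R) (a-a⁻¹ u) (a-a⁻¹ v)) ⟩
    π ⟨$⟩ʳ col R u v                          ∎
    where
    a⁻¹ : ℕ → ℕ
    a⁻¹ = Inverse.from a
    a-a⁻¹ : ∀ w → a $ a⁻¹ w ≡ w
    a-a⁻¹ = Inverse.strictlyInverseˡ a
    k≡g : ∀ w → k $ w ≡ g $ a⁻¹ w
    k≡g w = trans (cong (k $_) (sym (a-a⁻¹ w))) (sym (g≈ka (a⁻¹ w)))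
    a⁻¹u≢a⁻¹v : a⁻¹ u ≢ a⁻¹ v
    a⁻¹u≢a⁻¹v e = u≢v (trans (sym (a-a⁻¹ u)) (trans (cong (a $_) e) (a-a⁻¹ v)))

  moved-vertex-fixes-colour : ∀ {k τ} → (k ∘ₚ k) ≈ₚ idₚ → Induces k τ →
    ∀ u → k $ u ≢ u → τ ⟨$⟩ʳ col R u (k $ u) ≡ col R u (k $ u)
  moved-vertex-fixes-colour {k} {τ} kk≈id k-τ u ku≢u = begin
    τ ⟨$⟩ʳ col R u (k $ u)       ≡⟨ k-τ u (k $ u) (ku≢u ∘ sym) ⟨
    col R (k $ u) (k $ (k $ u))  ≡⟨ cong (col R (k $ u)) (kk≈id u) ⟩
    col R (k $ u) u              ≡⟨ col-sym R (k $ u) u ⟩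
    col R u (k $ u)              ∎

  involution-fixes-colour : ∀ {k τ} → (k ∘ₚ k) ≈ₚ idₚ → Induces k τ → ∃ λ c → τ ⟨$⟩ʳ c ≡ c
  involution-fixes-colour {k} {τ} kk≈id k-τ with k $ 0 ≟ 0 | k $ 1 ≟ 1
  ... | no k0≢0   | _         = _ , moved-vertex-fixes-colour {k} {τ} kk≈id k-τ 0 k0≢0
  ... | yes _     | no k1≢1   = _ , moved-vertex-fixes-colour {k} {τ} kk≈id k-τ 1 k1≢1
  ... | yes k0≡0  | yes k1≡1  = col R 0 1 , (begin
    τ ⟨$⟩ʳ col R 0 1       ≡⟨ k-τ 0 1 (λ ()) ⟨
    col R (k $ 0) (k $ 1)  ≡⟨ cong₂ (col R) k0≡0 k1≡1 ⟩
    col R 0 1              ∎)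

  splitting-lifts : (s : Splits R) → ∀ {g π} → Induces g π → ∃ λ κ → proj₁ s κ × Induces κ π
  splitting-lifts (_ , _ , _ , K·Aut) {g} {π} g-π with K·Aut g (π , g-π)
  ... | κ , a , κ∈K , a-aut , g≈κa = κ , κ∈K , factor-induces {g} {κ} {a} {π} g≈κa a-aut g-π

  splitting-involution : (s : Splits R) → ∀ {κ τ} → proj₁ s κ → Induces κ τ →
    (∀ c → τ ⟨$⟩ʳ (τ ⟨$⟩ʳ c) ≡ c) → (κ ∘ₚ κ) ≈ₚ idₚ
  splitting-involution (_ , K≤Aut* , K∩Aut≈id , _) {κ} {τ} κ∈K κ-τ τ-inv =
    K∩Aut≈id _ (IsSubgroupOfAut*.∘-closed K≤Aut* κ∈K κ∈K)
      (λ u v u≢v → trans (induces-∘ {κ} {κ} {τ} {τ} κ-τ κ-τ u v u≢v) (τ-inv _))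

  involutive-derangement⇒¬splits : Universal R → Homogeneous R → (τ : Permutation′ m) →
    (∀ c → τ ⟨$⟩ʳ (τ ⟨$⟩ʳ c) ≡ c) → (∀ c → τ ⟨$⟩ʳ c ≢ c) → ¬ Splits R
  involutive-derangement⇒¬splits universal homogeneous τ τ-inv τ-derangement s
    with every-colour-permutation-induced universal homogeneous τ
  ... | g , g-τ with splitting-lifts s {g} {τ} g-τ
  ... | κ , κ∈K , κ-τ =
    let c , τc≡c = involution-fixes-colour {κ} {τ} (splitting-involution s {κ} {τ} κ∈K κ-τ τ-inv) κ-τ
    in τ-derangement c τc≡c

  homomorphic-section⇒splits : ExtensionProperty (col R) → (s : Permutation′ m → Perm) →
    (∀ σ → Induces (s σ) σ) →
    (∀ σ τ → s (σ ↔-∘ τ) ≈ₚ (s σ ∘ₚ s τ)) →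
    (∀ σ → (∀ c → σ ⟨$⟩ʳ c ≡ c) → s σ ≈ₚ idₚ) →
    Splits R
  homomorphic-section⇒splits ext s s-induces s-∘ s-trivial = K , K-subgroup , K∩Aut≈id , K·Aut
    where
    K : Perm → Set
    K g = ∃ λ σ → g ≈ₚ s σ

    s-cancel : ∀ σ x → s σ $ (s (↔-sym σ) $ x) ≡ x
    s-cancel σ x = trans (sym (s-∘ σ (↔-sym σ) x)) (s-trivial (σ ↔-∘ ↔-sym σ) (λ _ → inverseʳ σ) x)

    K-subgroup : IsSubgroupOfAut* R K
    K-subgroup = record
      { resp      = λ { g≈h (σ , g≈sσ) → σ , λ x → trans (sym (g≈h x)) (g≈sσ x) }
      ; ⊆Aut*     = λ { {g} (σ , g≈sσ) → σ , λ u v u≢v →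
                      trans (cong₂ (col R) (g≈sσ u) (g≈sσ v)) (s-induces σ u v u≢v) }
      ; has-id    = ↔-id _ , λ x → sym (s-trivial (↔-id _) (λ _ → refl) x)
      ; ∘-closed  = λ { {g} {h} (σ , g≈sσ) (τ , h≈sτ) → σ ↔-∘ τ , λ x →
                      trans (g≈sσ (h $ x)) (trans (cong (s σ $_) (h≈sτ x)) (sym (s-∘ σ τ x))) }
      ; ⁻¹-closed = λ { {g} (σ , g≈sσ) → ↔-sym σ , λ x → $-injective g
                      (trans (Inverse.strictlyInverseˡ g x)
                        (sym (trans (g≈sσ _) (s-cancel σ x)))) }
      }

    K∩Aut≈id : ∀ g → K g → IsAut R g → g ≈ₚ idₚ
    K∩Aut≈id g (σ , g≈sσ) g-aut x = trans (g≈sσ x) (s-trivial σ σ-trivial x)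
      where
      σ-trivial : ∀ c → σ ⟨$⟩ʳ c ≡ c
      σ-trivial c with colour-occurs ext 0 c
      ... | u , v , u≢v , refl =
        trans (sym (s-induces σ u v u≢v)) (trans (cong₂ (col R) (sym (g≈sσ u)) (sym (g≈sσ v))) (g-aut u v u≢v))

    K·Aut : ∀ g → IsAut* R g → ∃ λ κ → ∃ λ a → K κ × IsAut R a × g ≈ₚ (κ ∘ₚ a)
    K·Aut g (π , g-π) = s π , s (↔-sym π) ∘ₚ g , (π , λ _ → refl) , a-aut , λ x → sym (s-cancel π (g $ x))
      where
      a-aut : IsAut R (s (↔-sym π) ∘ₚ g)
      a-aut u v u≢v = trans (induces-∘ {s (↔-sym π)} {g} {↔-sym π} {π} (s-induces (↔-sym π)) g-π u v u≢v)
                            (inverseˡ π)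

Even : ℕ → Set
Even m = ∃ λ k → m ≡ 2 * k

even-or-odd : ∀ m → Even m ⊎ Odd m
even-or-odd zero = inj₁ (0 , refl)
even-or-odd (suc m) with even-or-odd m
... | inj₁ (k , refl) = inj₂ (k , refl)
... | inj₂ (k , refl) = inj₁ (suc k , cong suc (sym (+-suc k (k + 0))))

opposite-fixed-point⇒odd : ∀ {n} (i : Fin n) → opposite i ≡ i → Odd n
opposite-fixed-point⇒odd {n} i opp-i≡i = t , (begin
  n                 ≡⟨ m∸n+n≡m (toℕ<n i) ⟨
  n ∸ suc t + suc t ≡⟨ cong (_+ suc t) (trans (sym (opposite-prop i)) (cong toℕ opp-i≡i)) ⟩
  t + suc t         ≡⟨ +-suc t t ⟩
  suc (t + t)       ≡⟨ cong (λ s → suc (t + s)) (+-identityʳ t) ⟨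
  suc (2 * t)       ∎)
  where
  open ≡-Reasoning
  t : ℕ
  t = toℕ i

even⇒¬splits : ∀ {m} (R : ColGraph m ℕ) → Universal R → Homogeneous R →
  Even m → ¬ Splits R
even⇒¬splits R universal homogeneous (k , refl) =
  involutive-derangement⇒¬splits R universal homogeneous
    (mk↔ₛ′ opposite opposite opposite-involutive opposite-involutive) opposite-involutive
    (λ c opp-c≡c → let t , 2k≡1+2t = opposite-fixed-point⇒odd c opp-c≡c in even≢odd k t 2k≡1+2t)

module _ {n : ℕ} where

  [_<_] : Fin n → Fin n → ℕ
  [ x < y ] with x F.<? y
  ... | yes _ = 1
  ... | no  _ = 0

  [<]+[>]≡1 : ∀ {x y} → x ≢ y → [ x < y ] + [ y < x ] ≡ 1
  [<]+[>]≡1 {x} {y} x≢y with x F.<? y | y F.<? x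
  ... | yes x<y | yes y<x = ⊥-elim (F.<-asym x<y y<x)
  ... | yes _   | no  _   = refl
  ... | no  _   | yes _   = refl
  ... | no  x≮y | no  y≮x = ⊥-elim (x≢y (F.≤-antisym (≮⇒≥ y≮x) (≮⇒≥ x≮y)))

sum-ones : ∀ n → sum {n} (λ _ → 1) ≡ n
sum-ones zero    = refl
sum-ones (suc n) = cong suc (sum-ones n)

fixed-point-free-involution⇒even : ∀ {n} (γ : Fin n → Fin n) → (∀ x → γ (γ x) ≡ x) →
  (∀ x → γ x ≢ x) → Even n
fixed-point-free-involution⇒even {n} γ γ-inv γ-free = sum up , (begin
  n                                 ≡⟨ sum-ones n ⟨
  sum {n} (λ _ → 1)                 ≡⟨ sum-cong-≗ (λ x → sym ([<]+[>]≡1 (γ-free x ∘ sym))) ⟩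
  sum (λ x → up x + [ γ x < x ])    ≡⟨ ∑-distrib-+ up (λ x → [ γ x < x ]) ⟩
  sum up + sum (λ x → [ γ x < x ])  ≡⟨ cong (sum up +_) up∘γ ⟨
  sum up + sum up                   ≡⟨ cong (sum up +_) (+-identityʳ (sum up)) ⟨
  2 * sum up                        ∎)
  where
  open ≡-Reasoning
  up : Fin n → ℕ
  up x = [ x < γ x ]
  up∘γ : sum up ≡ sum (λ x → [ γ x < x ])
  up∘γ = trans (sum-permute up (mk↔ₛ′ γ γ γ-inv γ-inv))
               (sum-cong-≗ (λ x → cong (λ y → [ γ x < y ]) (γ-inv x)))

odd-involution-has-fixed-point : ∀ {n} → Odd n → (γ : Fin n → Fin n) → (∀ x → γ (γ x) ≡ x) →
  ∃ λ x → γ x ≡ x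
odd-involution-has-fixed-point (k , refl) γ γ-inv with any? (λ x → γ x F.≟ x)
... | yes fixed = fixed
... | no  free  =
  let s , 1+2k≡2s = fixed-point-free-involution⇒even γ γ-inv (λ x γx≡x → free (x , γx≡x))
  in ⊥-elim (even≢odd s k (sym 1+2k≡2s))

maximum : ∀ {n} → (Fin n → ℕ) → ℕ
maximum {zero}  f = 0
maximum {suc n} f = f zero ⊔ maximum (f ∘ suc)

≤-maximum : ∀ {n} (f : Fin n → ℕ) i → f i ≤ maximum f
≤-maximum f zero    = m≤m⊔n _ _
≤-maximum f (suc i) = ≤-trans (≤-maximum (f ∘ suc) i) (m≤n⊔m (f zero) _)

module Digits (b : ℕ) .{{_ : NonZero b}} where

  -- Opaque so that encodings over a concrete base are not unfolded during unification.
  opaque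
    encode : ∀ {k} → Vec (Fin b) k → ℕ → ℕ
    encode []       r = r
    encode (d ∷ ds) r = toℕ d + encode ds r * b

    [d+qb]mod≡d : ∀ (d : Fin b) q → (toℕ d + q * b) mod b ≡ d
    [d+qb]mod≡d d q = trans (fromℕ<-cong _ _ [d+qb]%b≡d _ (toℕ<n d)) (fromℕ<-toℕ d (toℕ<n d))
      where
      [d+qb]%b≡d : (toℕ d + q * b) % b ≡ toℕ d
      [d+qb]%b≡d = trans ([m+kn]%n≡m%n (toℕ d) q b) (m<n⇒m%n≡m (toℕ<n d))

    [d+qb]/b≡q : ∀ (d : Fin b) q → (toℕ d + q * b) / b ≡ q
    [d+qb]/b≡q d q = begin
      (toℕ d + q * b) / b     ≡⟨ +-distrib-/-∣ʳ (toℕ d) (n∣m*n q) ⟩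
      toℕ d / b + q * b / b   ≡⟨ cong₂ _+_ (m<n⇒m/n≡0 (toℕ<n d)) (m*n/n≡m q b) ⟩
      q                       ∎
      where open ≡-Reasoning

    digitAt : ℕ → ℕ → Fin b
    digitAt zero    n = n mod b
    digitAt (suc p) n = digitAt p (n / b)

    digitAt-encode : ∀ {k} (ds : Vec (Fin b) k) r (p : Fin k) →
      digitAt (toℕ p) (encode ds r) ≡ lookup ds p
    digitAt-encode (d ∷ ds) r zero    = [d+qb]mod≡d d (encode ds r)
    digitAt-encode (d ∷ ds) r (suc p) =
      trans (cong (digitAt (toℕ p)) ([d+qb]/b≡q d (encode ds r))) (digitAt-encode ds r p)

    decode : ∀ k → ℕ → Vec (Fin b) k × ℕ
    decode zero    n = [] , n
    decode (suc k) n = map₁ (n mod b ∷_) (decode k (n / b))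

    decode-encode : ∀ {k} (ds : Vec (Fin b) k) r → decode k (encode ds r) ≡ (ds , r)
    decode-encode []       r = refl
    decode-encode (d ∷ ds) r
      rewrite [d+qb]/b≡q d (encode ds r) | decode-encode ds r | [d+qb]mod≡d d (encode ds r) = refl

    encode-injective : ∀ {k} {ds ds′ : Vec (Fin b) k} {r r′} →
      encode ds r ≡ encode ds′ r′ → (ds , r) ≡ (ds′ , r′)
    encode-injective {ds = ds} {ds′} {r} {r′} e =
      trans (sym (decode-encode ds r)) (trans (cong (decode _) e) (decode-encode ds′ r′))

    encode-≥ : ∀ {k} (ds : Vec (Fin b) k) r → r ≤ encode ds r
    encode-≥ []       r = ≤-refl
    encode-≥ (d ∷ ds) r = begin
      r                        ≤⟨ encode-≥ ds r ⟩
      encode ds r              ≤⟨ m≤m*n (encode ds r) b ⟩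
      encode ds r * b          ≤⟨ m≤n+m _ (toℕ d) ⟩
      toℕ d + encode ds r * b  ∎
      where open ≤-Reasoning

  prescribe-digits : ∀ {n} (pos : Fin n → ℕ) → Injective _≡_ _≡_ pos → (d : Fin n → Fin b) →
    ∀ r → ∃ λ N → r ≤ N × (∀ i → digitAt (pos i) N ≡ d i)
  prescribe-digits {n} pos pos-inj d r = encode digits r , encode-≥ digits r , digit-pos
    where
    wanted : ℕ → Fin b
    wanted p with any? (λ i → pos i ≟ p)
    ... | yes (i , _) = d i
    ... | no  _       = 0 mod b
    wanted-pos : ∀ i → wanted (pos i) ≡ d i
    wanted-pos i with any? (λ j → pos j ≟ pos i)
    ... | yes (j , pj≡pi) = cong d (pos-inj pj≡pi)
    ... | no  ¬found      = ⊥-elim (¬found (i , refl))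
    digits : Vec (Fin b) (suc (maximum pos))
    digits = tabulate (wanted ∘ toℕ)
    digit-pos : ∀ i → digitAt (pos i) (encode digits r) ≡ d i
    digit-pos i = begin
      digitAt (pos i) (encode digits r)
        ≡⟨ cong (λ p → digitAt p (encode digits r)) (toℕ-fromℕ< pos<) ⟨
      digitAt (toℕ (fromℕ< pos<)) (encode digits r)
        ≡⟨ digitAt-encode digits r (fromℕ< pos<) ⟩
      lookup digits (fromℕ< pos<)
        ≡⟨ lookup∘tabulate (wanted ∘ toℕ) (fromℕ< pos<) ⟩
      wanted (toℕ (fromℕ< pos<))
        ≡⟨ cong wanted (toℕ-fromℕ< pos<) ⟩
      wanted (pos i)
        ≡⟨ wanted-pos i ⟩
      d i
        ∎
      where
      open ≡-Reasoning
      pos< : pos i < suc (maximum pos)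
      pos< = s≤s (≤-maximum pos i)

lookup-ext : ∀ {A : Set} {n} {u v : Vec A n} → (∀ t → lookup u t ≡ lookup v t) → u ≡ v
lookup-ext {u = u} {v} u≗v = trans (sym (tabulate∘lookup u)) (trans (tabulate-cong u≗v) (tabulate∘lookup v))

module OddVertices (k : ℕ) where

  m : ℕ
  m = suc (2 * k)

  open Digits m

  Word : Set
  Word = Vec (Fin m) m

  Inverses : Word → Word → Set
  Inverses ρ ρ⁻¹ = (∀ t → lookup ρ⁻¹ (lookup ρ t) ≡ t) × (∀ t → lookup ρ (lookup ρ⁻¹ t) ≡ t)

  inverses? : ∀ ρ ρ⁻¹ → Dec (Inverses ρ ρ⁻¹)
  inverses? ρ ρ⁻¹ = all? (λ t → lookup ρ⁻¹ (lookup ρ t) F.≟ t) ×-dec all? (λ t → lookup ρ (lookup ρ⁻¹ t) F.≟ t)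

  -- The vertex (level, ρ) of ℕ × Sym(m), with ρ and ρ⁻¹ stored as words so that vertices
  -- have decidable equality and can be enumerated.
  record Vertex : Set where
    constructor vertex
    field
      level     : ℕ
      perm      : Word
      perm⁻¹    : Word
      .inverses : Inverses perm perm⁻¹

  open Vertex

  ρ ρ⁻¹ : Vertex → Fin m → Fin m
  ρ   x = lookup (perm x)
  ρ⁻¹ x = lookup (perm⁻¹ x)

  ρ⁻¹-ρ : ∀ x t → ρ⁻¹ x (ρ x t) ≡ t
  ρ⁻¹-ρ (vertex _ π π⁻¹ inv) = proj₁ (recompute (inverses? π π⁻¹) inv)

  ρ-ρ⁻¹ : ∀ x t → ρ x (ρ⁻¹ x t) ≡ t
  ρ-ρ⁻¹ (vertex _ π π⁻¹ inv) = proj₂ (recompute (inverses? π π⁻¹) inv)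

  fromFunctions : ℕ → (f g : Fin m → Fin m) → (∀ t → g (f t) ≡ t) → (∀ t → f (g t) ≡ t) → Vertex
  fromFunctions i f g g∘f f∘g = vertex i (tabulate f) (tabulate g)
    ( (λ t → trans (lookup∘tabulate g _) (trans (cong g (lookup∘tabulate f t)) (g∘f t)))
    , (λ t → trans (lookup∘tabulate f _) (trans (cong f (lookup∘tabulate g t)) (f∘g t))) )

  identityVertex : ℕ → Vertex
  identityVertex i = fromFunctions i id id (λ _ → refl) (λ _ → refl)

  perm-unique : ∀ {x y} → perm⁻¹ x ≡ perm⁻¹ y → perm x ≡ perm y
  perm-unique {x} {y} e = lookup-ext λ t → begin
    ρ x t                 ≡⟨ cong (ρ x) (ρ⁻¹-ρ y t) ⟨
    ρ x (ρ⁻¹ y (ρ y t))   ≡⟨ cong (λ w → ρ x (lookup w (ρ y t))) e ⟨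
    ρ x (ρ⁻¹ x (ρ y t))   ≡⟨ ρ-ρ⁻¹ x (ρ y t) ⟩
    ρ y t                 ∎
    where open ≡-Reasoning

  vertex-≡ : ∀ {x y} → level x ≡ level y → perm⁻¹ x ≡ perm⁻¹ y → x ≡ y
  vertex-≡ {x@(vertex _ _ _ _)} {y@(vertex _ _ _ _)} refl e with perm-unique {x} {y} e | e
  ... | refl | refl = refl

  _≟ᵥ_ : DecidableEquality Vertex
  x ≟ᵥ y = map′ (λ (e , e′) → vertex-≡ e e′) (λ { refl → refl , refl })
    (level x ≟ level y ×-dec ≡-dec F._≟_ (perm⁻¹ x) (perm⁻¹ y))

  fromCode : Word × Word × ℕ → Vertex
  fromCode (π , π⁻¹ , i) with inverses? π π⁻¹
  ... | yes inv = vertex i π π⁻¹ inv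
  ... | no  _   = identityVertex i

  enumerate : ℕ → Vertex
  enumerate n = fromCode (map₂ (decode m) (decode m n))

  enumerate-onto : ∀ x → ∃ λ n → enumerate n ≡ x
  enumerate-onto (vertex i π π⁻¹ inv) = encode π (encode π⁻¹ i) , (begin
    enumerate (encode π (encode π⁻¹ i))  ≡⟨ cong (fromCode ∘ map₂ (decode m)) (decode-encode π _) ⟩
    fromCode (π , decode m (encode π⁻¹ i)) ≡⟨ cong (λ c → fromCode (π , c)) (decode-encode π⁻¹ i) ⟩
    fromCode (π , π⁻¹ , i)               ≡⟨ fromCode-valid ⟩
    vertex i π π⁻¹ inv                   ∎)
    where
    open ≡-Reasoning
    fromCode-valid : fromCode (π , π⁻¹ , i) ≡ vertex i π π⁻¹ inv
    fromCode-valid with inverses? π π⁻¹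
    ... | yes _      = refl
    ... | no  ¬valid = ⊥-elim (¬valid (recompute (no ¬valid) inv))

  _·_ : Permutation′ m → Vertex → Vertex
  σ · x = fromFunctions (level x) (λ t → σ ⟨$⟩ʳ ρ x t) (λ t → ρ⁻¹ x (σ ⟨$⟩ˡ t))
    (λ t → trans (cong (ρ⁻¹ x) (inverseˡ σ)) (ρ⁻¹-ρ x t))
    (λ t → trans (cong (σ ⟨$⟩ʳ_) (ρ-ρ⁻¹ x _)) (inverseʳ σ))

  ρ-· : ∀ σ x t → ρ (σ · x) t ≡ σ ⟨$⟩ʳ ρ x t
  ρ-· σ x = lookup∘tabulate (λ t → σ ⟨$⟩ʳ ρ x t)

  ρ⁻¹-· : ∀ σ x t → ρ⁻¹ (σ · x) t ≡ ρ⁻¹ x (σ ⟨$⟩ˡ t)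
  ρ⁻¹-· σ x = lookup∘tabulate (λ t → ρ⁻¹ x (σ ⟨$⟩ˡ t))

  ·-∘ : ∀ σ τ x → σ · (τ · x) ≡ (σ ↔-∘ τ) · x
  ·-∘ σ τ x = vertex-≡ refl (lookup-ext λ t →
    trans (ρ⁻¹-· σ (τ · x) t) (trans (ρ⁻¹-· τ x _) (sym (ρ⁻¹-· (σ ↔-∘ τ) x t))))

  ·-identity : ∀ σ → (∀ c → σ ⟨$⟩ʳ c ≡ c) → ∀ x → σ · x ≡ x
  ·-identity σ σ≗id x = vertex-≡ refl (lookup-ext λ t →
    trans (ρ⁻¹-· σ x t) (cong (ρ⁻¹ x) (trans (cong (σ ⟨$⟩ˡ_) (sym (σ≗id t))) (inverseˡ σ))))

  ·-cancel : ∀ σ x → σ · (↔-sym σ · x) ≡ x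
  ·-cancel σ x = trans (·-∘ σ (↔-sym σ) x) (·-identity (σ ↔-∘ ↔-sym σ) (λ _ → inverseʳ σ) x)

  ·-injective : ∀ σ {x y} → σ · x ≡ σ · y → x ≡ y
  ·-injective σ {x} {y} e =
    trans (sym (·-cancel (↔-sym σ) x)) (trans (cong (↔-sym σ ·_) e) (·-cancel (↔-sym σ) y))

  relative : Vertex → Vertex → Word
  relative x y = tabulate (λ t → ρ⁻¹ x (ρ y t))

  relative-· : ∀ σ x y → relative (σ · x) (σ · y) ≡ relative x y
  relative-· σ x y = tabulate-cong λ t → begin
    ρ⁻¹ (σ · x) (ρ (σ · y) t)        ≡⟨ cong (ρ⁻¹ (σ · x)) (ρ-· σ y t) ⟩
    ρ⁻¹ (σ · x) (σ ⟨$⟩ʳ ρ y t)       ≡⟨ ρ⁻¹-· σ x (σ ⟨$⟩ʳ ρ y t) ⟩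
    ρ⁻¹ x (σ ⟨$⟩ˡ (σ ⟨$⟩ʳ ρ y t))    ≡⟨ cong (ρ⁻¹ x) (inverseˡ σ) ⟩
    ρ⁻¹ x (ρ y t)                    ∎
    where open ≡-Reasoning

  lookup-relative : ∀ x y t → lookup (relative x y) t ≡ ρ⁻¹ x (ρ y t)
  lookup-relative x y = lookup∘tabulate (λ t → ρ⁻¹ x (ρ y t))

  ρ-relative : ∀ x y t → ρ x (lookup (relative x y) t) ≡ ρ y t
  ρ-relative x y t = trans (cong (ρ x) (lookup-relative x y t)) (ρ-ρ⁻¹ x (ρ y t))

  relative-inverses : ∀ x y → Inverses (relative x y) (relative y x)
  relative-inverses x y = cancel x y , cancel y x
    where
    cancel : ∀ x y t → lookup (relative y x) (lookup (relative x y) t) ≡ t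
    cancel x y t = trans (lookup-relative y x _) (trans (cong (ρ⁻¹ y) (ρ-relative x y t)) (ρ⁻¹-ρ y t))

  fixedPoint : Word → Fin m
  fixedPoint γ with any? (λ t → lookup γ t F.≟ t)
  ... | yes (t , _) = t
  ... | no  _       = zero

  fixedPoint-fixed : ∀ γ → (∀ t → lookup γ (lookup γ t) ≡ t) → lookup γ (fixedPoint γ) ≡ fixedPoint γ
  fixedPoint-fixed γ γ-inv with any? (λ t → lookup γ t F.≟ t)
  ... | yes (_ , γt≡t) = γt≡t
  ... | no  free       = ⊥-elim (free (odd-involution-has-fixed-point (k , refl) (lookup γ) γ-inv))

  code : Word → ℕ
  code γ = encode γ 0

  -- The colour of {x, y} is ρₓ applied to an offset computed from levels and from
  -- γ = ρₓ⁻¹ρ_y and γ⁻¹ only, which makes it equivariant. Between levels i < j the offset is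
  -- the digit of j at position encode γ i, so a fresh level can prescribe its colour towards
  -- every older vertex; within a level, codes of γ and γ⁻¹ break the tie unless γ = γ⁻¹.

  tieOffset : ∀ γ γ′ → Tri (code γ < code γ′) (code γ ≡ code γ′) (code γ′ < code γ) → Fin m
  tieOffset γ γ′ (tri< _ _ _) = zero
  tieOffset γ γ′ (tri≈ _ _ _) = fixedPoint γ
  tieOffset γ γ′ (tri> _ _ _) = lookup γ zero

  offsetBy : ∀ i j → Tri (i < j) (i ≡ j) (j < i) → Word → Word → Fin m
  offsetBy i j (tri< _ _ _) γ γ′ = digitAt (encode γ i) j
  offsetBy i j (tri≈ _ _ _) γ γ′ = tieOffset γ γ′ (<-cmp (code γ) (code γ′))
  offsetBy i j (tri> _ _ _) γ γ′ = lookup γ (digitAt (encode γ′ j) i)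

  colour : Vertex → Vertex → Fin m
  colour x y =
    ρ x (offsetBy (level x) (level y) (<-cmp (level x) (level y)) (relative x y) (relative y x))

  tieOffset-flip : ∀ {γ γ′} → Inverses γ γ′ → ∀ t t′ → tieOffset γ γ′ t ≡ lookup γ (tieOffset γ′ γ t′)
  tieOffset-flip (_ , γγ′) (tri< _ _ _)  (tri> _ _ _) = sym (γγ′ zero)
  tieOffset-flip _         (tri> _ _ _)  (tri< _ _ _) = refl
  tieOffset-flip {γ} {γ′} (γ′γ , _) (tri≈ _ e _) (tri≈ _ _ _) with encode-injective {ds = γ} {γ′} e
  ... | refl = sym (fixedPoint-fixed γ γ′γ)
  tieOffset-flip _ (tri< a _ _) (tri< b _ _) = ⊥-elim (<-asym a b)
  tieOffset-flip _ (tri< _ ¬e _) (tri≈ _ e _) = ⊥-elim (¬e (sym e))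
  tieOffset-flip _ (tri≈ _ e _) (tri< _ ¬e _) = ⊥-elim (¬e (sym e))
  tieOffset-flip _ (tri≈ _ e _) (tri> _ ¬e _) = ⊥-elim (¬e (sym e))
  tieOffset-flip _ (tri> _ ¬e _) (tri≈ _ e _) = ⊥-elim (¬e (sym e))
  tieOffset-flip _ (tri> _ _ a) (tri> _ _ b) = ⊥-elim (<-asym a b)

  offsetBy-flip : ∀ {i j γ γ′} → Inverses γ γ′ → ∀ t t′ →
    offsetBy i j t γ γ′ ≡ lookup γ (offsetBy j i t′ γ′ γ)
  offsetBy-flip (_ , γγ′) (tri< _ _ _) (tri> _ _ _) = sym (γγ′ _)
  offsetBy-flip _         (tri> _ _ _) (tri< _ _ _) = refl
  offsetBy-flip {γ = γ} {γ′} inv (tri≈ _ _ _) (tri≈ _ _ _) =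
    tieOffset-flip inv (<-cmp (code γ) (code γ′)) (<-cmp (code γ′) (code γ))
  offsetBy-flip _ (tri< a _ _) (tri< b _ _) = ⊥-elim (<-asym a b)
  offsetBy-flip _ (tri< a _ _) (tri≈ _ e _) = ⊥-elim (<-irrefl (sym e) a)
  offsetBy-flip _ (tri≈ _ e _) (tri< b _ _) = ⊥-elim (<-irrefl (sym e) b)
  offsetBy-flip _ (tri≈ _ e _) (tri> _ _ b) = ⊥-elim (<-irrefl e b)
  offsetBy-flip _ (tri> _ _ a) (tri≈ _ e _) = ⊥-elim (<-irrefl e a)
  offsetBy-flip _ (tri> _ _ a) (tri> _ _ b) = ⊥-elim (<-asym a b)

  colour-sym : ∀ x y → colour x y ≡ colour y x
  colour-sym x y = begin
    colour x y
      ≡⟨ cong (ρ x) (offsetBy-flip {i} {j} {γ} {γ′} (relative-inverses x y) (<-cmp i j) tji) ⟩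
    ρ x (lookup γ (offsetBy j i tji γ′ γ))
      ≡⟨ ρ-relative x y _ ⟩
    colour y x
      ∎
    where
    open ≡-Reasoning
    i j : ℕ
    i = level x
    j = level y
    tji : Tri (j < i) (j ≡ i) (i < j)
    tji = <-cmp j i
    γ γ′ : Word
    γ = relative x y
    γ′ = relative y x

  colour-· : ∀ σ x y → colour (σ · x) (σ · y) ≡ σ ⟨$⟩ʳ colour x y
  colour-· σ x y = trans
    (cong₂ (λ γ γ′ → ρ (σ · x) (offsetBy (level x) (level y) (<-cmp (level x) (level y)) γ γ′))
      (relative-· σ x y) (relative-· σ y x))
    (ρ-· σ x _)

  extension : ExtensionProperty colour
  extension n a a-inj f = z , z∉a , colour-z
    where
    key : Fin n → ℕ
    key i = encode (perm⁻¹ (a i)) (level (a i))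
    key-injective : Injective _≡_ _≡_ key
    key-injective e = let e′ = encode-injective e in a-inj (vertex-≡ (cong proj₂ e′) (cong proj₁ e′))
    prescribed : ∃ λ N → suc (maximum key) ≤ N × (∀ i → digitAt (key i) N ≡ ρ⁻¹ (a i) (f i))
    prescribed = prescribe-digits key key-injective (λ i → ρ⁻¹ (a i) (f i)) (suc (maximum key))
    z : Vertex
    z = identityVertex (proj₁ prescribed)
    level<z : ∀ i → level (a i) < level z
    level<z i = ≤-trans (s≤s (≤-trans (encode-≥ (perm⁻¹ (a i)) (level (a i))) (≤-maximum key i)))
                        (proj₁ (proj₂ prescribed))
    z∉a : ∀ i → a i ≢ z
    z∉a i e = <-irrefl (cong level e) (level<z i)
    relative-z : ∀ i → relative (a i) z ≡ perm⁻¹ (a i)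
    relative-z i = lookup-ext λ t → trans (lookup-relative (a i) z t) (cong (ρ⁻¹ (a i)) (lookup∘tabulate id t))
    digit-key : ∀ i → digitAt (key i) (level z) ≡ ρ⁻¹ (a i) (f i)
    digit-key = proj₂ (proj₂ prescribed)
    colour-z-by : ∀ i t →
      ρ (a i) (offsetBy (level (a i)) (level z) t (relative (a i) z) (relative z (a i))) ≡ f i
    colour-z-by i (tri< _ _ _)  = begin
      ρ (a i) (digitAt (encode (relative (a i) z) (level (a i))) (level z))
        ≡⟨ cong (λ γ → ρ (a i) (digitAt (encode γ (level (a i))) (level z))) (relative-z i) ⟩
      ρ (a i) (digitAt (key i) (level z))
        ≡⟨ cong (ρ (a i)) (digit-key i) ⟩
      ρ (a i) (ρ⁻¹ (a i) (f i))
        ≡⟨ ρ-ρ⁻¹ (a i) (f i) ⟩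
      f i
        ∎
      where open ≡-Reasoning
    colour-z-by i (tri≈ _ e _)  = ⊥-elim (<-irrefl e (level<z i))
    colour-z-by i (tri> _ _ z<) = ⊥-elim (<-asym z< (level<z i))
    colour-z : ∀ i → colour (a i) z ≡ f i
    colour-z i = colour-z-by i (<-cmp (level (a i)) (level z))

  module Transport (R : ColGraph m ℕ) (copy : Vertex ↔ ℕ)
    (φ-col : ∀ x y → x ≢ y → col R (Inverse.to copy x) (Inverse.to copy y) ≡ colour x y) where

    open ≡-Reasoning

    φ : Vertex → ℕ
    φ = Inverse.to copy
    φ⁻¹ : ℕ → Vertex
    φ⁻¹ = Inverse.from copy
    φ-φ⁻¹ : ∀ u → φ (φ⁻¹ u) ≡ u
    φ-φ⁻¹ = Inverse.strictlyInverseˡ copy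
    φ⁻¹-φ : ∀ x → φ⁻¹ (φ x) ≡ x
    φ⁻¹-φ = Inverse.strictlyInverseʳ copy

    act : Permutation′ m → ℕ → ℕ
    act σ u = φ (σ · φ⁻¹ u)

    act-cancel : ∀ σ u → act σ (act (↔-sym σ) u) ≡ u
    act-cancel σ u = begin
      φ (σ · φ⁻¹ (φ (↔-sym σ · φ⁻¹ u)))  ≡⟨ cong (λ x → φ (σ · x)) (φ⁻¹-φ (↔-sym σ · φ⁻¹ u)) ⟩
      φ (σ · (↔-sym σ · φ⁻¹ u))          ≡⟨ cong φ (·-cancel σ (φ⁻¹ u)) ⟩
      φ (φ⁻¹ u)                          ≡⟨ φ-φ⁻¹ u ⟩
      u                                  ∎

    section : Permutation′ m → Perm
    section σ = mk↔ₛ′ (act σ) (act (↔-sym σ)) (act-cancel σ) (act-cancel (↔-sym σ))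

    section-induces : ∀ σ → Induces R (section σ) σ
    section-induces σ u v u≢v = begin
      col R (φ (σ · x)) (φ (σ · y))  ≡⟨ φ-col (σ · x) (σ · y) (x≢y ∘ ·-injective σ) ⟩
      colour (σ · x) (σ · y)         ≡⟨ colour-· σ x y ⟩
      σ ⟨$⟩ʳ colour x y              ≡⟨ cong (σ ⟨$⟩ʳ_) (φ-col x y x≢y) ⟨
      σ ⟨$⟩ʳ col R (φ x) (φ y)       ≡⟨ cong (σ ⟨$⟩ʳ_) (cong₂ (col R) (φ-φ⁻¹ u) (φ-φ⁻¹ v)) ⟩
      σ ⟨$⟩ʳ col R u v               ∎
      where
      x = φ⁻¹ u
      y = φ⁻¹ v
      x≢y : x ≢ y
      x≢y e = u≢v (trans (sym (φ-φ⁻¹ u)) (trans (cong φ e) (φ-φ⁻¹ v)))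

    section-∘ : ∀ σ τ → section (σ ↔-∘ τ) ≈ₚ (section σ ∘ₚ section τ)
    section-∘ σ τ u = begin
      φ ((σ ↔-∘ τ) · φ⁻¹ u)          ≡⟨ cong φ (·-∘ σ τ (φ⁻¹ u)) ⟨
      φ (σ · (τ · φ⁻¹ u))            ≡⟨ cong (λ x → φ (σ · x)) (φ⁻¹-φ (τ · φ⁻¹ u)) ⟨
      φ (σ · φ⁻¹ (φ (τ · φ⁻¹ u)))    ∎

    section-trivial : ∀ σ → (∀ c → σ ⟨$⟩ʳ c ≡ c) → section σ ≈ₚ idₚ
    section-trivial σ σ-trivial u = trans (cong φ (·-identity σ σ-trivial (φ⁻¹ u))) (φ-φ⁻¹ u)

odd⇒splits : ∀ {m} (R : ColGraph m ℕ) → Odd m → Universal R → Homogeneous R → Splits R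
odd⇒splits R (k , refl) universal homogeneous =
  homomorphic-section⇒splits R ext section section-induces section-∘ section-trivial
  where
  open OddVertices k
  ext : ExtensionProperty (col R)
  ext = universal-homogeneous⇒extension R universal homogeneous
  copy : Σ (Vertex ↔ ℕ) λ φ → ∀ x y → x ≢ y → col R (Inverse.to φ x) (Inverse.to φ y) ≡ colour x y
  copy = BackAndForth.back-and-forth _≟ᵥ_ _≟_ colour-sym (col-sym R) extension ext
           enumerate enumerate-onto id (_, refl)
  open Transport R (proj₁ copy) (proj₂ copy)

theorem1 : (m : ℕ) → 2 ≤ m → (R : ColGraph m ℕ) → Universal R → Homogeneous R →
    Splits R ⇔ Odd m
theorem1 m _ R universal homogeneous = mk⇔ splits⇒odd (λ odd → odd⇒splits R odd universal homogeneous)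
  where
  splits⇒odd : Splits R → Odd m
  splits⇒odd split with even-or-odd m
  ... | inj₁ even = ⊥-elim (even⇒¬splits R universal homogeneous even split)
  ... | inj₂ odd  = odd
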